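{- For all integers $d\ge 4$, we have $R_f(d)\le 16\cdot d^2\cdot 2^{(\log_2\log_2 d)^2}$.
   Context: For an integer $n\ge 1$, ${\overset{\leftrightarrow}{K}}_n$ denotes the complete bidirected graph on $n$ vertices: for every pair of distinct vertices $u,v$ it has both directed edges $(u,v)$ and $(v,u)$. For an integer $d>0$ and $[d]=\{1,\dots,d\}$, a $d$-labeling of ${\overset{\leftrightarrow}{K}}_n$ assigns to every directed edge $e$ a function $\ell_e:[d]\to[d]$. A cycle means a simple directed cycle. If a cycle has edges $e_1,\dots,e_k$ in this order with labels $f_1,\dots,f_k$, it is a fixed-point cycle if the map $x\mapsto f_k(f_{k-1}(\cdots f_1(x)\cdots))$ has a fixed point in $[d]$. $R_f(d)$ is the largest $n$ such that there exists a $d$-labeling of ${\overset{\leftrightarrow}{K}}_n$ with no fixed-point cycle. -}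

module Defs where

open import Data.Nat using (ℕ; zero; suc; _+_; _*_; _^_; _≤_; _<_)
open import Data.Fin using (Fin)
open import Data.List using (List; []; _∷_; length)
open import Data.List.Relation.Unary.Unique.Propositional using (Unique)
open import Data.Product using (Σ; ∃; _×_)
open import Relation.Binary.PropositionalEquality using (_≡_)
open import Relation.Nullary using (¬_)

-- A d-labeling of the complete bidirected graph on vertex set Fin n:
-- the directed edge (u , v) gets the label ℓ u v : [d] → [d], with [d] = Fin d.
-- (Values ℓ u u on the diagonal correspond to no edge and are never used,
-- since cycles below are simple with at least 2 vertices.)
Labeling : ℕ → ℕ → Set
Labeling n d = Fin n → Fin n → (Fin d → Fin d)

pathMap : ∀ {n d} → Labeling n d → List (Fin n) → Fin d → Fin d
pathMap ℓ [] x = x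
pathMap ℓ (v ∷ []) x = x
pathMap ℓ (u ∷ v ∷ vs) x = pathMap ℓ (v ∷ vs) (ℓ u v x)

lastOf : ∀ {n} → Fin n → List (Fin n) → Fin n
lastOf v [] = v
lastOf v (w ∷ ws) = lastOf w ws

-- A directed cycle given by its vertex sequence v₀, …, v_{k-1}: a simple cycle
-- iff the vertices are pairwise distinct and k ≥ 2 (no loops in the graph).
IsCycle : ∀ {n} → List (Fin n) → Set
IsCycle cs = Unique cs × (2 ≤ length cs)

cycleMap : ∀ {n d} → Labeling n d → List (Fin n) → Fin d → Fin d
cycleMap ℓ [] x = x
cycleMap ℓ (v ∷ vs) x = ℓ (lastOf v vs) v (pathMap ℓ (v ∷ vs) x)

IsFixedPointCycle : ∀ {n d} → Labeling n d → List (Fin n) → Set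
IsFixedPointCycle {d = d} ℓ cs = Σ (Fin d) (λ x → cycleMap ℓ cs x ≡ x)

NoFixedPointCycle : ∀ {n d} → Labeling n d → Set
NoFixedPointCycle ℓ = ∀ cs → IsCycle cs → ¬ IsFixedPointCycle ℓ cs

-- Exact integer encoding of the real inequality
--     n ≤ 16 · d² · 2^{(log₂ log₂ d)²}      (for d ≥ 4, so log₂ log₂ d ≥ 1):
-- it holds iff for every rational r/s (s > 0) with r/s > log₂ log₂ d we have
--     n < 16 · d² · 2^{(r/s)²},   i.e.   n^{s²} < 2^{r²} · (16·d²)^{s²}.
RfBound : ℕ → ℕ → Set
RfBound n d =
  ∀ (r s : ℕ) → 0 < s →
  (∃ λ p → ∃ λ q → 0 < q × d ^ q < 2 ^ p × p ^ s < 2 ^ r * q ^ s) →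
  n ^ (s * s) < 2 ^ (r * r) * (16 * (d * d)) ^ (s * s)

{-# OPTIONS --safe #-}
module Submission where

-- Colour the vertices by f : Fin n → Fin d and call v a dead end if no u ≢ v has
-- ℓ v u (f v) ≡ f u. For a uniformly random f each vertex is a dead end with
-- probability (1 - 1/d)^(n-1), so the expected number of dead ends, n (1 - 1/d)^(n-1),
-- is below 1 as soon as n > 16 d², and counting over all d^n colourings yields an f
-- without dead ends. Then every vertex has an out-edge carrying its colour to the
-- colour of the head; following such edges until a vertex repeats closes a simple
-- cycle around which f is carried, so the colour of any vertex on it is a fixed point.
-- This gives R_f(d) ≤ 16 d² for d ≥ 2, which is below 16 d² 2^((log₂ log₂ d)²).

open import Defs
open import Data.Fin using (Fin; zero; suc; punchIn)
open import Data.Fin.Properties using (_≟_; pigeonhole; punchInᵢ≢i)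
import Data.Fin.Properties as Fin
open import Data.List using (List; []; _∷_; _∷ʳ_; length; lookup)
open import Data.List.Properties using (length-++)
open import Data.List.Membership.Propositional using (_∈_; _∉_)
open import Data.List.Membership.Propositional.Properties using (∈-lookup)
open import Data.List.Relation.Unary.All as All using ([]; _∷_)
open import Data.List.Relation.Unary.AllPairs using ([]; _∷_)
open import Data.List.Relation.Unary.Any using (here; there)
open import Data.List.Relation.Unary.Linked using (Linked; []; [-]; _∷_)
open import Data.List.Relation.Unary.Unique.Propositional using (Unique)
import Data.List.Relation.Unary.Unique.Propositional.Properties as Unique
open import Data.Nat hiding (_≟_)
open import Data.Nat.Properties hiding (_≟_)
open import Data.Nat.Tactic.RingSolver using (solve-∀)
open import Data.Product using (∃; _×_; _,_; proj₂)
open import Data.Sum using (inj₁; inj₂)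
open import Data.Vec.Functional using () renaming (_∷_ to _∷ᶠ_)
open import Function using (_∘_)
open import Relation.Binary.Core using (Rel)
open import Relation.Binary.PropositionalEquality
open import Relation.Nullary using (¬_; Dec; yes; no; ¬?; contradiction)
open import Relation.Nullary.Decidable using (decidable-stable)
open import Algebra.Properties.CommutativeSemigroup *-commutativeSemigroup using (x∙yz≈y∙xz)
open import Algebra.Properties.Semiring.Sum +-*-semiring
  using (sum; sum-cong-≗; sum-remove; ∑-comm; *-distribˡ-sum; *-distribʳ-sum)
open import Algebra.Properties.CommutativeMonoid.Sum *-1-commutativeMonoid
  using () renaming (sum to product; sum-remove to product-remove)

sum-const : ∀ {k c} {g : Fin k → ℕ} → (∀ i → g i ≡ c) → sum g ≡ k * c
sum-const {zero}  _   = refl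
sum-const {suc k} g≡c = cong₂ _+_ (g≡c zero) (sum-const (g≡c ∘ suc))

product-const : ∀ {k c} {g : Fin k → ℕ} → (∀ i → g i ≡ c) → product g ≡ c ^ k
product-const {zero}  _   = refl
product-const {suc k} g≡c = cong₂ _*_ (g≡c zero) (product-const (g≡c ∘ suc))

sum-spike : ∀ {k x y} (g : Fin (suc k) → ℕ) v →
            g v ≡ x → (∀ u → u ≢ v → g u ≡ y) → sum g ≡ x + k * y
sum-spike g v gv≡x g≡y = trans (sum-remove {i = v} g)
  (cong₂ _+_ gv≡x (sum-const (λ i → g≡y (punchIn v i) (punchInᵢ≢i v i))))

product-spike : ∀ {k x y} (g : Fin (suc k) → ℕ) v →
                g v ≡ x → (∀ u → u ≢ v → g u ≡ y) → product g ≡ x * y ^ k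
product-spike g v gv≡x g≡y = trans (product-remove {i = v} g)
  (cong₂ _*_ gv≡x (product-const (λ i → g≡y (punchIn v i) (punchInᵢ≢i v i))))

sum≡0⇒≡0 : ∀ {k} (g : Fin k → ℕ) → sum g ≡ 0 → ∀ i → g i ≡ 0
sum≡0⇒≡0 g ∑g≡0 zero    = m+n≡0⇒m≡0 (g zero) ∑g≡0
sum≡0⇒≡0 g ∑g≡0 (suc i) = sum≡0⇒≡0 (g ∘ suc) (m+n≡0⇒n≡0 (g zero) ∑g≡0) i

product≡0⇒∃≡0 : ∀ {k} (g : Fin k → ℕ) → product g ≡ 0 → ∃ λ i → g i ≡ 0
product≡0⇒∃≡0 {zero}  g ()
product≡0⇒∃≡0 {suc k} g ∏g≡0 with m*n≡0⇒m≡0∨n≡0 (g zero) ∏g≡0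
... | inj₁ g0≡0 = zero , g0≡0
... | inj₂ ∏g'≡0 = let i , gi≡0 = product≡0⇒∃≡0 (g ∘ suc) ∏g'≡0 in suc i , gi≡0

sum<*⇒∃< : ∀ {k c} (g : Fin k → ℕ) → sum g < k * c → ∃ λ i → g i < c
sum<*⇒∃< {zero}      g ()
sum<*⇒∃< {suc k} {c} g ∑g<kc with g zero <? c
... | yes g0<c = zero , g0<c
... | no  g0≮c =
  let i , gi<c = sum<*⇒∃< (g ∘ suc)
                   (+-cancelˡ-< c _ _ (≤-<-trans (+-monoˡ-≤ _ (≮⇒≥ g0≮c)) ∑g<kc))
  in suc i , gi<c

∑ᶠ : ∀ {d} n → ((Fin n → Fin d) → ℕ) → ℕ
∑ᶠ zero    F = F (λ ())
∑ᶠ (suc n) F = sum λ a → ∑ᶠ n (F ∘ (a ∷ᶠ_))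

∑ᶠ-*ˡ : ∀ {d} n c (F : (Fin n → Fin d) → ℕ) → ∑ᶠ n (λ f → c * F f) ≡ c * ∑ᶠ n F
∑ᶠ-*ˡ zero    c F = refl
∑ᶠ-*ˡ (suc n) c F = trans (sum-cong-≗ λ a → ∑ᶠ-*ˡ n c (F ∘ (a ∷ᶠ_)))
                          (sym (*-distribˡ-sum c (λ a → ∑ᶠ n (F ∘ (a ∷ᶠ_)))))

∑ᶠ-sum : ∀ {d k} n (G : Fin k → (Fin n → Fin d) → ℕ) →
         ∑ᶠ n (λ f → sum λ i → G i f) ≡ sum λ i → ∑ᶠ n (G i)
∑ᶠ-sum zero    G = refl
∑ᶠ-sum (suc n) G = trans (sum-cong-≗ λ a → ∑ᶠ-sum n (λ i → G i ∘ (a ∷ᶠ_)))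
                         (∑-comm λ a i → ∑ᶠ n (G i ∘ (a ∷ᶠ_)))

∑ᶠ-product : ∀ {d} n (w : Fin n → Fin d → ℕ) →
             ∑ᶠ n (λ f → product λ u → w u (f u)) ≡ product λ u → sum (w u)
∑ᶠ-product zero    w = refl
∑ᶠ-product (suc n) w = begin
  sum (λ a → ∑ᶠ n λ g → w zero a * product λ u → w (suc u) (g u))
    ≡⟨ sum-cong-≗ (λ a → ∑ᶠ-*ˡ n (w zero a) _) ⟩
  sum (λ a → w zero a * ∑ᶠ n λ g → product λ u → w (suc u) (g u))
    ≡⟨ sum-cong-≗ (λ a → cong (w zero a *_) (∑ᶠ-product n (w ∘ suc))) ⟩
  sum (λ a → w zero a * product λ u → sum (w (suc u)))
    ≡⟨ *-distribʳ-sum _ (w zero) ⟨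
  sum (w zero) * product (λ u → sum (w (suc u)))
    ∎
  where open ≡-Reasoning

∑ᶠ<^⇒∃≡0 : ∀ {d} n (F : (Fin n → Fin d) → ℕ) → ∑ᶠ n F < d ^ n → ∃ λ f → F f ≡ 0
∑ᶠ<^⇒∃≡0 zero    F F<1 = (λ ()) , n<1⇒n≡0 F<1
∑ᶠ<^⇒∃≡0 {d} (suc n) F ∑F<  =
  let a , ∑Fa<  = sum<*⇒∃< {c = d ^ n} (λ a → ∑ᶠ n (F ∘ (a ∷ᶠ_))) ∑F<
      f , Faf≡0 = ∑ᶠ<^⇒∃≡0 n (F ∘ (a ∷ᶠ_)) ∑Fa<
  in a ∷ᶠ f , Faf≡0

𝟙 : ∀ {p} {P : Set p} → Dec P → ℕ
𝟙 (yes _) = 1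
𝟙 (no  _) = 0

𝟙-yes : ∀ {p} {P : Set p} (P? : Dec P) → P → 𝟙 P? ≡ 1
𝟙-yes (yes _) _ = refl
𝟙-yes (no ¬P) P = contradiction P ¬P

𝟙-no : ∀ {p} {P : Set p} (P? : Dec P) → ¬ P → 𝟙 P? ≡ 0
𝟙-no (yes P) ¬P = contradiction P ¬P
𝟙-no (no _)  _  = refl

𝟙≡0⇒¬ : ∀ {p} {P : Set p} (P? : Dec P) → 𝟙 P? ≡ 0 → ¬ P
𝟙≡0⇒¬ P? 𝟙≡0 P = 1+n≢0 (trans (sym (𝟙-yes P? P)) 𝟙≡0)

∑𝟙[≡]≡1 : ∀ {k} (a : Fin (suc k)) → sum (λ c → 𝟙 (c ≟ a)) ≡ 1
∑𝟙[≡]≡1 {k} a = trans (sum-spike _ a (𝟙-yes (a ≟ a) refl) (λ c c≢a → 𝟙-no (c ≟ a) c≢a))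
                      (cong suc (*-zeroʳ k))

∑𝟙[≢]≡k : ∀ {k} (b : Fin (suc k)) → sum (λ c → 𝟙 (¬? (c ≟ b))) ≡ k
∑𝟙[≢]≡k {k} b = trans (sum-spike _ b (𝟙-no (¬? (b ≟ b)) (λ b≢b → b≢b refl))
                                     (λ c c≢b → 𝟙-yes (¬? (c ≟ b)) c≢b))
                      (*-identityʳ k)

-- Bernoulli's inequality (1 + 1/m)^k ≥ 1 + k/m, multiplied out.
m^k*[m+k]≤[1+m]^k*m : ∀ m k → m ^ k * (m + k) ≤ suc m ^ k * m
m^k*[m+k]≤[1+m]^k*m m zero    = *-monoʳ-≤ 1 (≤-reflexive (+-identityʳ m))
m^k*[m+k]≤[1+m]^k*m m (suc k) = begin
  m * m ^ k * (m + suc k)             ≡⟨ expand m k (m ^ k) ⟩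
  m * (m ^ k * (m + k)) + m * m ^ k   ≤⟨ +-mono-≤ (*-monoʳ-≤ m (m^k*[m+k]≤[1+m]^k*m m k))
                                                  (*-monoʳ-≤ m (^-monoˡ-≤ k (n≤1+n m))) ⟩
  m * (suc m ^ k * m) + m * suc m ^ k ≡⟨ collect m (suc m ^ k) ⟩
  suc m * suc m ^ k * m               ∎
  where
  open ≤-Reasoning
  expand : ∀ m k x → m * x * (m + suc k) ≡ m * (x * (m + k)) + m * x
  expand = solve-∀
  collect : ∀ m y → m * (y * m) + m * y ≡ suc m * y * m
  collect = solve-∀

1+k≤2^k : ∀ k → 1 + k ≤ 2 ^ k
1+k≤2^k k = begin
  1 + k           ≡⟨ *-identityˡ (1 + k) ⟨
  1 * (1 + k)     ≡⟨ cong (_* (1 + k)) (^-zeroˡ k) ⟨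
  1 ^ k * (1 + k) ≤⟨ m^k*[m+k]≤[1+m]^k*m 1 k ⟩
  2 ^ k * 1       ≡⟨ *-identityʳ (2 ^ k) ⟩
  2 ^ k           ∎
  where open ≤-Reasoning

2*m^m≤[1+m]^m : ∀ m .{{_ : NonZero m}} → 2 * m ^ m ≤ suc m ^ m
2*m^m≤[1+m]^m m = *-cancelʳ-≤ (2 * m ^ m) (suc m ^ m) m (begin
  2 * m ^ m * m     ≡⟨ double (m ^ m) m ⟩
  m ^ m * (m + m)   ≤⟨ m^k*[m+k]≤[1+m]^k*m m m ⟩
  suc m ^ m * m     ∎)
  where
  open ≤-Reasoning
  double : ∀ x m → 2 * x * m ≡ x * (m + m)
  double = solve-∀

^-distribʳ-* : ∀ a b j → (a * b) ^ j ≡ a ^ j * b ^ j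
^-distribʳ-* a b zero    = refl
^-distribʳ-* a b (suc j) = trans (cong (a * b *_) (^-distribʳ-* a b j))
                                 ([m*n]*[o*p]≡[m*o]*[n*p] a b (a ^ j) (b ^ j))

2^j*m^[m*j]≤[1+m]^[m*j] : ∀ m .{{_ : NonZero m}} j → 2 ^ j * m ^ (m * j) ≤ suc m ^ (m * j)
2^j*m^[m*j]≤[1+m]^[m*j] m j = begin
  2 ^ j * m ^ (m * j) ≡⟨ cong (2 ^ j *_) (^-*-assoc m m j) ⟨
  2 ^ j * (m ^ m) ^ j ≡⟨ ^-distribʳ-* 2 (m ^ m) j ⟨
  (2 * m ^ m) ^ j     ≤⟨ ^-monoˡ-≤ j (2*m^m≤[1+m]^m m) ⟩
  (suc m ^ m) ^ j     ≡⟨ ^-*-assoc (suc m) m j ⟩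
  suc m ^ (m * j)     ∎
  where open ≤-Reasoning

1+m*4d<2^4d : ∀ m → suc (m * (4 * suc m)) < 2 ^ (4 * suc m)
1+m*4d<2^4d m = begin-strict
  suc (m * (4 * d))            <⟨ m<m+n _ (*-monoʳ-< 8 z<s) ⟩
  suc (m * (4 * d)) + 8 * d    ≡⟨ square m ⟩
  (1 + 2 * d) * (1 + 2 * d)    ≤⟨ *-mono-≤ (1+k≤2^k (2 * d)) (1+k≤2^k (2 * d)) ⟩
  2 ^ (2 * d) * 2 ^ (2 * d)    ≡⟨ ^-distribˡ-+-* 2 (2 * d) (2 * d) ⟨
  2 ^ (2 * d + 2 * d)          ≡⟨ cong (2 ^_) (double d) ⟩
  2 ^ (4 * d)                  ∎
  where
  open ≤-Reasoning
  d = suc m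
  square : ∀ m → suc (m * (4 * suc m)) + 8 * suc m ≡ (1 + 2 * suc m) * (1 + 2 * suc m)
  square = solve-∀
  double : ∀ x → 2 * x + 2 * x ≡ 4 * x
  double = solve-∀

-- (n+1)(1 - 1/(m+1))^n < 1: fewer than one expected dead end among n + 1 vertices
-- coloured uniformly from m + 1 colours.
FewDeadEnds : ℕ → ℕ → Set
FewDeadEnds m n = suc n * m ^ n < suc m ^ n

FewDeadEnds-suc : ∀ {m n} → m ≤ suc n → FewDeadEnds m n → FewDeadEnds m (suc n)
FewDeadEnds-suc {m} {n} m≤1+n few = begin-strict
  suc (suc n) * (m * m ^ n)             ≡⟨ split n m (m ^ n) ⟩
  suc n * (m * m ^ n) + m * m ^ n       ≤⟨ +-monoʳ-≤ (suc n * (m * m ^ n)) (*-monoˡ-≤ (m ^ n) m≤1+n) ⟩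
  suc n * (m * m ^ n) + suc n * m ^ n   ≡⟨ merge n m (m ^ n) ⟩
  suc n * m ^ n * suc m                 <⟨ *-monoˡ-< (suc m) few ⟩
  suc m ^ n * suc m                     ≡⟨ *-comm (suc m ^ n) (suc m) ⟩
  suc m ^ suc n                         ∎
  where
  open ≤-Reasoning
  split : ∀ n m x → suc (suc n) * (m * x) ≡ suc n * (m * x) + m * x
  split = solve-∀
  merge : ∀ n m x → suc n * (m * x) + suc n * x ≡ suc n * x * suc m
  merge = solve-∀

-- At K = 4m(m+1), K + 1 < 2^(4(m+1)) ≤ (1 + 1/m)^K; from there on the left-hand side
-- grows by at most the factor m + 1 by which the right-hand side grows.
FewDeadEnds-≥ : ∀ m .{{_ : NonZero m}} {n} → m * (4 * suc m) ≤ n → FewDeadEnds m n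
FewDeadEnds-≥ m K≤n = from (≤⇒≤′ K≤n)
  where
  K = m * (4 * suc m)
  at-K : FewDeadEnds m K
  at-K = begin-strict
    suc K * m ^ K           <⟨ *-monoˡ-< (m ^ K) {{m^n≢0 m K}} (1+m*4d<2^4d m) ⟩
    2 ^ (4 * suc m) * m ^ K ≤⟨ 2^j*m^[m*j]≤[1+m]^[m*j] m (4 * suc m) ⟩
    suc m ^ K               ∎
    where open ≤-Reasoning
  from : ∀ {n} → K ≤′ n → FewDeadEnds m n
  from ≤′-refl        = at-K
  from (≤′-step K≤′n) =
    FewDeadEnds-suc (≤-trans (m≤m*n m (4 * suc m)) (m≤n⇒m≤1+n (≤′⇒≤ K≤′n))) (from K≤′n)

Carries : ∀ {n d} → Labeling n d → (Fin n → Fin d) → Rel (Fin n) _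
Carries ℓ x u v = u ≢ v × ℓ u v (x u) ≡ x v

module DeadEnds {n m} (ℓ : Labeling (suc n) (suc m)) where

  -- Σ_a Π_u weight v a u (f u) is 1 if v is a dead end of f and 0 otherwise (only
  -- a = f v can contribute). Summing over the guess a for f v, rather than reading it
  -- off f, makes each summand a product of factors depending on a single f u.
  weight : Fin (suc n) → Fin (suc m) → Fin (suc n) → Fin (suc m) → ℕ
  weight v a u with u ≟ v
  ... | yes _ = λ c → 𝟙 (c ≟ a)
  ... | no  _ = λ c → 𝟙 (¬? (c ≟ ℓ v u a))

  deadEnds : (Fin (suc n) → Fin (suc m)) → ℕ
  deadEnds f = sum λ v → sum λ a → product λ u → weight v a u (f u)

  ∑-weight-self : ∀ v a → sum (weight v a v) ≡ 1
  ∑-weight-self v a with v ≟ v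
  ... | yes _   = ∑𝟙[≡]≡1 a
  ... | no  v≢v = contradiction refl v≢v

  ∑-weight-other : ∀ {v u} a → u ≢ v → sum (weight v a u) ≡ m
  ∑-weight-other {v} {u} a u≢v with u ≟ v
  ... | yes u≡v = contradiction u≡v u≢v
  ... | no  _   = ∑𝟙[≢]≡k (ℓ v u a)

  ∏∑-weight : ∀ v a → product (λ u → sum (weight v a u)) ≡ m ^ n
  ∏∑-weight v a = trans (product-spike _ v (∑-weight-self v a) (λ _ → ∑-weight-other a))
                        (*-identityˡ (m ^ n))

  ∑ᶠ-deadEnds : ∑ᶠ (suc n) deadEnds ≡ suc n * (suc m * m ^ n)
  ∑ᶠ-deadEnds = begin
    ∑ᶠ (suc n) deadEnds
      ≡⟨ ∑ᶠ-sum (suc n) (λ v f → sum λ a → product λ u → weight v a u (f u)) ⟩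
    sum (λ v → ∑ᶠ (suc n) λ f → sum λ a → product λ u → weight v a u (f u))
      ≡⟨ sum-cong-≗ (λ v → ∑ᶠ-sum (suc n) (λ a f → product λ u → weight v a u (f u))) ⟩
    sum (λ v → sum λ a → ∑ᶠ (suc n) λ f → product λ u → weight v a u (f u))
      ≡⟨ sum-cong-≗ (λ v → sum-cong-≗ λ a → ∑ᶠ-product (suc n) (weight v a)) ⟩
    sum (λ v → sum λ a → product λ u → sum (weight v a u))
      ≡⟨ sum-const (λ v → sum-const (∏∑-weight v)) ⟩
    suc n * (suc m * m ^ n)
      ∎
    where open ≡-Reasoning

  weight≡0⇒carries : ∀ f v u → weight v (f v) u (f u) ≡ 0 → Carries ℓ f v u
  weight≡0⇒carries f v u w≡0 with u ≟ v
  ... | yes refl = contradiction refl (𝟙≡0⇒¬ (f v ≟ f v) w≡0)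
  ... | no  u≢v  = u≢v ∘ sym , sym (decidable-stable fu≟ (𝟙≡0⇒¬ (¬? fu≟) w≡0))
    where fu≟ = f u ≟ ℓ v u (f v)

  deadEnds≡0⇒successor : ∀ f → deadEnds f ≡ 0 → ∀ v → ∃ (Carries ℓ f v)
  deadEnds≡0⇒successor f deadEnds≡0 v =
    let u , w≡0 = product≡0⇒∃≡0 (λ u → weight v (f v) u (f u)) term-fv
    in u , weight≡0⇒carries f v u w≡0
    where
    term-fv : product (λ u → weight v (f v) u (f u)) ≡ 0
    term-fv = sum≡0⇒≡0 (λ a → product λ u → weight v a u (f u))
                (sum≡0⇒≡0 (λ v → sum λ a → product λ u → weight v a u (f u)) deadEnds≡0 v)
                (f v)

  deadEndFreeColouring : FewDeadEnds m n → ∃ λ f → ∀ v → ∃ (Carries ℓ f v)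
  deadEndFreeColouring few =
    let f , deadEnds≡0 = ∑ᶠ<^⇒∃≡0 (suc n) deadEnds expected<1
    in f , deadEnds≡0⇒successor f deadEnds≡0
    where
    d = suc m
    expected<1 : ∑ᶠ (suc n) deadEnds < d ^ suc n
    expected<1 = begin-strict
      ∑ᶠ (suc n) deadEnds     ≡⟨ ∑ᶠ-deadEnds ⟩
      suc n * (d * m ^ n)     ≡⟨ x∙yz≈y∙xz (suc n) d (m ^ n) ⟩
      d * (suc n * m ^ n)     <⟨ *-monoʳ-< d few ⟩
      d * d ^ n               ∎
      where open ≤-Reasoning

lookup-injective : ∀ {A : Set} {xs : List A} → Unique xs →
                   ∀ {i j} → lookup xs i ≡ lookup xs j → i ≡ j
lookup-injective (_    ∷ _)   {zero}  {zero}  _  = refl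
lookup-injective (x∉xs ∷ _)   {zero}  {suc j} eq = contradiction eq (All.lookup x∉xs (∈-lookup j))
lookup-injective (x∉xs ∷ _)   {suc i} {zero}  eq = contradiction (sym eq) (All.lookup x∉xs (∈-lookup i))
lookup-injective (_    ∷ xs!) {suc i} {suc j} eq = cong suc (lookup-injective xs! eq)

Unique⇒length≤ : ∀ {n} {xs : List (Fin n)} → Unique xs → length xs ≤ n
Unique⇒length≤ {n} {xs} xs! with length xs ≤? n
... | yes |xs|≤n = |xs|≤n
... | no  |xs|≰n =
  let i , j , i<j , eq = pigeonhole (≰⇒> |xs|≰n) (lookup xs)
  in contradiction (lookup-injective xs! eq) (Fin.<⇒≢ i<j)

Linked-∷ʳ : ∀ {n r} {R : Rel (Fin n) r} {w ws t} →
            Linked R (w ∷ ws) → R (lastOf w ws) t → Linked R (w ∷ ws ∷ʳ t)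
Linked-∷ʳ {ws = []}    [-]        Rwt = Rwt ∷ [-]
Linked-∷ʳ {ws = _ ∷ _} (Rww′ ∷ l) Rwt = Rww′ ∷ Linked-∷ʳ l Rwt

Unique-∷ʳ : ∀ {A : Set} {xs : List A} {t} → Unique xs → t ∉ xs → Unique (xs ∷ʳ t)
Unique-∷ʳ xs! t∉xs = Unique.++⁺ xs! ([] ∷ []) λ { (t∈xs , here refl) → t∉xs t∈xs }

record SimpleClosedWalk {n r} (R : Rel (Fin n) r) : Set r where
  field
    start  : Fin n
    rest   : List (Fin n)
    unique : Unique (start ∷ rest)
    linked : Linked R (start ∷ rest)
    closes : R (lastOf start rest) start

closeAt : ∀ {n r} {R : Rel (Fin n) r} {t} w ws → Unique (w ∷ ws) → Linked R (w ∷ ws) →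
          R (lastOf w ws) t → t ∈ w ∷ ws → SimpleClosedWalk R
closeAt w ws         ws!       l       Rt (here refl) = record
  { start = w ; rest = ws ; unique = ws! ; linked = l ; closes = Rt }
closeAt w (w′ ∷ ws) (_ ∷ ws!) (_ ∷ l) Rt (there t∈ws) = closeAt w′ ws ws! l Rt t∈ws

length-∷ʳ : ∀ {A : Set} (xs : List A) x → length (xs ∷ʳ x) ≡ suc (length xs)
length-∷ʳ xs x = trans (length-++ xs) (+-comm (length xs) 1)

module _ {n r} {R : Rel (Fin n) r} (successor : ∀ v → ∃ (R v)) where
  open import Data.List.Membership.DecPropositional (_≟_ {n}) using (_∈?_)

  -- k is fuel: a Unique list of vertices has at most n elements.
  private
    grow : ∀ k w ws → Unique (w ∷ ws) → Linked R (w ∷ ws) → n ≤ k + length ws →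
           SimpleClosedWalk R
    grow zero    w ws ws! _ n≤ = contradiction (≤-trans (Unique⇒length≤ ws!) n≤) 1+n≰n
    grow (suc k) w ws ws! l n≤ with successor (lastOf w ws)
    ... | t , Rt with t ∈? (w ∷ ws)
    ...   | yes t∈ = closeAt w ws ws! l Rt t∈
    ...   | no  t∉ = grow k w (ws ∷ʳ t) (Unique-∷ʳ ws! t∉) (Linked-∷ʳ l Rt)
                       (subst (n ≤_) (sym (trans (cong (k +_) (length-∷ʳ ws t)) (+-suc k _))) n≤)

  simpleClosedWalk : Fin n → SimpleClosedWalk R
  simpleClosedWalk v = grow n v [] ([] ∷ []) [-] (m≤m+n n 0)

module _ {n d} {ℓ : Labeling n d} {x : Fin n → Fin d} where

  pathMap-carries : ∀ {v vs} → Linked (Carries ℓ x) (v ∷ vs) →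
                    pathMap ℓ (v ∷ vs) (x v) ≡ x (lastOf v vs)
  pathMap-carries [-]                          = refl
  pathMap-carries {vs = w ∷ ws} ((_ , eq) ∷ l) =
    trans (cong (pathMap ℓ (w ∷ ws)) eq) (pathMap-carries l)

  fixedPointCycle : SimpleClosedWalk (Carries ℓ x) → ∃ λ cs → IsCycle cs × IsFixedPointCycle ℓ cs
  fixedPointCycle record { start = t ; rest = ts ; unique = ts! ; linked = l ; closes = closes } =
    t ∷ ts , (ts! , 2≤length ts closes) , x t , x-fixed
    where
    x-fixed : cycleMap ℓ (t ∷ ts) (x t) ≡ x t
    x-fixed = trans (cong (ℓ (lastOf t ts) t) (pathMap-carries l)) (proj₂ closes)
    2≤length : ∀ ts → Carries ℓ x (lastOf t ts) t → 2 ≤ length (t ∷ ts)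
    2≤length []      (t≢t , _) = contradiction refl t≢t
    2≤length (_ ∷ _) _         = s≤s (s≤s z≤n)

fixedPointCycle-beyond-16d² : ∀ {n d} → 2 ≤ d → 16 * (d * d) < n → (ℓ : Labeling n d) →
                              ∃ λ cs → IsCycle cs × IsFixedPointCycle ℓ cs
fixedPointCycle-beyond-16d² {suc n} {suc (suc m)} (s≤s (s≤s z≤n)) 16d²<1+n ℓ =
  let f , successor = DeadEnds.deadEndFreeColouring ℓ (FewDeadEnds-≥ (suc m) K≤n)
  in fixedPointCycle (simpleClosedWalk successor zero)
  where
  d = suc (suc m)
  K≤n : suc m * (4 * d) ≤ n
  K≤n = begin
    suc m * (4 * d)   ≤⟨ *-monoˡ-≤ (4 * d) (n≤1+n (suc m)) ⟩
    d * (4 * d)       ≡⟨ regroup d ⟩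
    4 * (d * d)       ≤⟨ *-monoˡ-≤ (d * d) (m≤m+n 4 12) ⟩
    16 * (d * d)      ≤⟨ ≤-pred 16d²<1+n ⟩
    n                 ∎
    where
    open ≤-Reasoning
    regroup : ∀ d → d * (4 * d) ≡ 4 * (d * d)
    regroup = solve-∀

NoFixedPointCycle⇒≤16d² : ∀ {n d} → 2 ≤ d → (ℓ : Labeling n d) → NoFixedPointCycle ℓ →
                          n ≤ 16 * (d * d)
NoFixedPointCycle⇒≤16d² 2≤d ℓ noFixedPoint = ≮⇒≥ λ 16d²<n →
  let cs , cycle , fixedPoint = fixedPointCycle-beyond-16d² 2≤d 16d²<n ℓ
  in noFixedPoint cs cycle fixedPoint

log₂log₂<r/s⇒r>0 : ∀ {d p q r s} → 2 ≤ d → d ^ q < 2 ^ p → p ^ s < 2 ^ r * q ^ s → 0 < r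
log₂log₂<r/s⇒r>0 {p = p} {q} {zero} {s} 2≤d dq<2p ps<qs with p <? q
... | yes p<q = contradiction (≤-trans (^-monoʳ-≤ 2 (<⇒≤ p<q)) (^-monoˡ-≤ q 2≤d)) (<⇒≱ dq<2p)
... | no  p≮q = contradiction (^-monoˡ-≤ s (≮⇒≥ p≮q))
                             (<⇒≱ (≤-trans ps<qs (≤-reflexive (+-identityʳ _))))
log₂log₂<r/s⇒r>0 {r = suc r} _ _ _ = z<s

≤16d²⇒RfBound : ∀ {n d} → 2 ≤ d → n ≤ 16 * (d * d) → RfBound n d
≤16d²⇒RfBound {n} {d} 2≤d@(s≤s (s≤s z≤n)) n≤16d² r s _ (p , q , _ , dq<2p , ps<2ʳqs) =
  begin-strict
  n ^ (s * s)                       ≤⟨ ^-monoˡ-≤ (s * s) n≤16d² ⟩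
  B ^ (s * s)                       ≡⟨ *-identityˡ _ ⟨
  1 * B ^ (s * s)                   <⟨ *-monoˡ-< (B ^ (s * s)) {{m^n≢0 B (s * s)}} 1<2^r² ⟩
  2 ^ (r * r) * B ^ (s * s)         ∎
  where
  open ≤-Reasoning
  B = 16 * (d * d)
  r>0 = log₂log₂<r/s⇒r>0 {p = p} {q} {r} {s} 2≤d dq<2p ps<2ʳqs
  1<2^r² : 1 < 2 ^ (r * r)
  1<2^r² = ^-monoʳ-< 2 (s≤s (s≤s z≤n)) (*-mono-≤ r>0 r>0)

lemma10 : ∀ (d : ℕ) → 4 ≤ d → ∀ (n : ℕ) (ℓ : Labeling n d) →
          NoFixedPointCycle ℓ → RfBound n d
lemma10 d 4≤d n ℓ noFixedPoint =
  ≤16d²⇒RfBound 2≤d (NoFixedPointCycle⇒≤16d² 2≤d ℓ noFixedPoint)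
  where
  2≤d : 2 ≤ d
  2≤d = ≤-trans (s≤s (s≤s z≤n)) 4≤d
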